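{- Let $G$ be a finite simple graph and $v$ a vertex of degree $d_1$ having exactly $d_2$ vertices at distance exactly $2$ from $v$. Let $c$ be a strong locally identifying colouring of $G$ using strictly more than $d_1+2d_2$ colours. Then there is a list $L$ of colours with $|L|\leq d_1+2d_2$ such that if we change the colour of $v$ (and only of $v$) to any colour not in $L$, the resulting colouring is still a strong locally identifying colouring.
   Context: For a vertex $u$, $N[u]$ is its closed neighbourhood (the vertex together with its neighbours); for a colouring $c$ and vertex set $S$, $c(S)=\{c(u):u\in S\}$. A locally identifying colouring is a proper vertex colouring $c$ such that for every pair of adjacent vertices $u,v$ with $N[u]\neq N[v]$, $c(N[u])\neq c(N[v])$. A strong locally identifying colouring (slid-colouring) is a locally identifying colouring such that for each vertex $u$ all colours of vertices in $N[u]$ are distinct; equivalently, a colouring in which any two distinct vertices at distance at most $2$ receive different colours and which is locally identifying. -}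

module Defs where

open import Data.Nat using (ℕ)
open import Data.Bool using (Bool; true; false; not; _∧_; if_then_else_)
open import Data.Fin using (Fin)
open import Data.Fin.Properties using (_≟_)
open import Data.List using (List; length; filterᵇ)
open import Data.Bool.ListAction using (any)
open import Data.List using () renaming (allFin to allFinL)
open import Data.Product using (Σ; _×_; ∃)
open import Data.Sum using (_⊎_)
open import Relation.Nullary using (¬_; does)
open import Relation.Binary.PropositionalEquality using (_≡_; _≢_)
open import Function.Bundles using (_⇔_)

record SimpleGraph (n : ℕ) : Set where
  field
    edge   : Fin n → Fin n → Bool
    sym    : ∀ u v → edge u v ≡ edge v u
    irrefl : ∀ v → edge v v ≡ false

module _ {n : ℕ} (G : SimpleGraph n) where
  open SimpleGraph G

  Adj : Fin n → Fin n → Set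
  Adj u v = edge u v ≡ true

  degree : Fin n → ℕ
  degree v = length (filterᵇ (edge v) (allFinL n))

  atDist2 : Fin n → Fin n → Bool
  atDist2 v w = not (does (w ≟ v)) ∧ not (edge v w)
                ∧ any (λ x → edge v x ∧ edge x w) (allFinL n)

  dist2Count : Fin n → ℕ
  dist2Count v = length (filterᵇ (atDist2 v) (allFinL n))

  InN : Fin n → Fin n → Set
  InN u w = w ≡ u ⊎ Adj u w

  module _ {C : Set} (c : Fin n → C) where
    ColIn : Fin n → C → Set
    ColIn u a = Σ (Fin n) λ w → InN u w × c w ≡ a

    Proper : Set
    Proper = ∀ u v → Adj u v → c u ≢ c v

    LocallyIdentifying : Set
    LocallyIdentifying =
      Proper ×
      (∀ u v → Adj u v →
        ¬ (∀ w → InN u w ⇔ InN v w) →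
        ¬ (∀ a → ColIn u a ⇔ ColIn v a))

    StronglyLocallyIdentifying : Set
    StronglyLocallyIdentifying =
      LocallyIdentifying ×
      (∀ u w w' → InN u w → InN u w' → w ≢ w' → c w ≢ c w')

recolour : {n : ℕ} {C : Set} → (Fin n → C) → Fin n → C → Fin n → C
recolour c v a w = if does (w ≟ v) then a else c w

-- Recolouring v only changes the colour sets c(N[u]) with v ∈ N[u], and the other vertices of
-- such an N[u] lie at distance 1 or 2 from v. Avoiding their d₁ + d₂ colours keeps the colouring
-- injective on closed neighbourhoods, and keeps it identifying on every edge uw whose
-- neighbourhoods both contain or both miss v. The remaining edges have v ∈ N[u] and w at
-- distance 2; if the new colour of v appears in N[w], it is carried by a vertex whose colour
-- avoids the near colours, so N[w] has such an "escaping" colour. Forbidding one escaping colour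
-- per vertex at distance 2 (d₂ more colours) makes that colour lie in c′(N[w]) but not in c′(N[u]).
module Submission where

open import Defs
open import Data.Nat using (ℕ; _+_; _*_; _≤_; _<_)
open import Data.Nat.Properties using (+-monoʳ-≤; +-assoc; +-identityʳ; module ≤-Reasoning)
open import Data.Bool using (true)
import Data.Bool as Bool
open import Data.Bool.Properties using (T-≡; T-not-≡; T-∧; ¬-not)
open import Data.Fin using (Fin)
open import Data.Fin.Properties using (_≟_; any?)
open import Data.List using (List; length; map; _++_; filterᵇ; mapMaybe) renaming (allFin to allFinL)
open import Data.List.Properties using (length-++; length-map; length-mapMaybe)
open import Data.List.Membership.Propositional using (_∈_; _∉_; lose)
open import Data.List.Membership.Propositional.Properties using (∈-allFin; ∈-filter⁺; ∈-map⁺; ∈-++⁺ˡ; ∈-++⁺ʳ)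
import Data.List.Membership.DecPropositional as DecMembership
open import Data.List.Relation.Unary.Any.Properties using (any⁺; map⁺; mapMaybe⁺)
open import Data.Maybe using (Maybe; just)
import Data.Maybe as Maybe
import Data.Maybe.Relation.Unary.Any as MaybeAny
open import Data.Product using (Σ; _×_; _,_; ∃; proj₁; proj₂)
open import Data.Sum using (_⊎_; inj₁; inj₂)
open import Data.Empty using (⊥-elim)
open import Function.Base using (_∘_)
open import Function.Bundles using (_⇔_; mk⇔; Equivalence)
import Function.Properties.Equivalence as ⇔
open import Relation.Nullary using (¬_; Dec; yes; no; contradiction)
open import Relation.Nullary.Decidable using (T?; dec⇒maybe; dec-true; dec-false; _⊎-dec_; _×-dec_; ¬?)
open import Relation.Binary.PropositionalEquality using (_≡_; _≢_; refl; sym; trans; cong; cong₂; subst)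

open Equivalence using (to; from)

∈-mapMaybe⁺ : ∀ {A B : Set} {f : A → Maybe B} {xs : List A} {x : A} {y : B} →
  x ∈ xs → f x ≡ just y → y ∈ mapMaybe f xs
∈-mapMaybe⁺ {f = f} {xs} x∈xs fx≡y =
  mapMaybe⁺ f xs (map⁺ (lose x∈xs (subst (MaybeAny.Any (_ ≡_)) (sym fx≡y) (MaybeAny.just refl))))

module _ {n : ℕ} (G : SimpleGraph n) where
  open SimpleGraph G using (edge; irrefl)

  Adj-sym : ∀ {u w} → Adj G u w → Adj G w u
  Adj-sym {u} {w} uw = trans (SimpleGraph.sym G w u) uw

  InN-sym : ∀ {u w} → InN G u w → InN G w u
  InN-sym (inj₁ refl) = inj₁ refl
  InN-sym (inj₂ uw)   = inj₂ (Adj-sym uw)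

  InN? : ∀ u w → Dec (InN G u w)
  InN? u w = (w ≟ u) ⊎-dec (edge u w Bool.≟ true)

  InjectiveOnBalls : {C : Set} → (Fin n → C) → Set
  InjectiveOnBalls c = ∀ u w w' → InN G u w → InN G u w' → w ≢ w' → c w ≢ c w'

  injectiveOnBalls⇒proper : {C : Set} {c : Fin n → C} → InjectiveOnBalls c → Proper G c
  injectiveOnBalls⇒proper inj u w uw = inj u u w (inj₁ refl) (inj₂ uw) u≢w
    where
    u≢w : u ≢ w
    u≢w refl = contradiction (trans (sym uw) (irrefl u)) λ ()

module Recolouring {n k : ℕ} (G : SimpleGraph n) (v : Fin n) (c : Fin n → Fin k) where
  open SimpleGraph G using (edge)
  open DecMembership (_≟_ {k}) using (_∈?_)

  sphere₁ sphere₂ : List (Fin n)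
  sphere₁ = filterᵇ (edge v) (allFinL n)
  sphere₂ = filterᵇ (atDist2 G v) (allFinL n)

  ∈-sphere₁ : ∀ {x} → Adj G v x → x ∈ sphere₁
  ∈-sphere₁ {x} vx = ∈-filter⁺ (T? ∘ edge v) (∈-allFin x) (from T-≡ vx)

  ∈-sphere₂ : ∀ {u w} → InN G u v → InN G u w → ¬ InN G v w → w ∈ sphere₂
  ∈-sphere₂ (inj₁ refl) vw          ¬vw = contradiction vw ¬vw
  ∈-sphere₂ (inj₂ uv)   (inj₁ refl) ¬vw = contradiction (inj₂ (Adj-sym G uv)) ¬vw
  ∈-sphere₂ {u} {w} (inj₂ uv) (inj₂ uw) ¬vw =
    ∈-filter⁺ (T? ∘ atDist2 G v) (∈-allFin w)
      (from T-∧ (from T-not-≡ (dec-false (w ≟ v) (¬vw ∘ inj₁)) ,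
       from T-∧ (from T-not-≡ (¬-not (¬vw ∘ inj₂)) ,
       any⁺ _ (lose (∈-allFin u) (from T-∧ (from T-≡ (Adj-sym G uv) , from T-≡ uw))))))

  nearColours : List (Fin k)
  nearColours = map c sphere₁ ++ map c sphere₂

  nearColours-ball : ∀ {u x} → InN G u x → InN G u v → x ≢ v → c x ∈ nearColours
  nearColours-ball {x = x} ux uv x≢v with InN? G v x
  ... | yes (inj₁ x≡v) = contradiction x≡v x≢v
  ... | yes (inj₂ vx)  = ∈-++⁺ˡ (∈-map⁺ c (∈-sphere₁ vx))
  ... | no ¬vx = ∈-++⁺ʳ (map c sphere₁) (∈-map⁺ c (∈-sphere₂ uv ux ¬vx))

  Escape : Fin n → Fin n → Set
  Escape w x = InN G w x × c x ∉ nearColours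

  escape? : ∀ w → Dec (∃ (Escape w))
  escape? w = any? λ x → InN? G w x ×-dec ¬? (c x ∈? nearColours)

  escapeColour : Fin n → Maybe (Fin k)
  escapeColour w = Maybe.map (c ∘ proj₁) (dec⇒maybe (escape? w))

  escapeColours : List (Fin k)
  escapeColours = mapMaybe escapeColour sphere₂

  escapeColours-cover : ∀ {w} → w ∈ sphere₂ → ∃ (Escape w) → ∃ λ x → Escape w x × c x ∈ escapeColours
  escapeColours-cover {w} w∈ e with escape? w in eq
  ... | yes (x , ex) = x , ex , ∈-mapMaybe⁺ w∈ (cong (Maybe.map (c ∘ proj₁) ∘ dec⇒maybe) eq)
  ... | no ¬e        = contradiction e ¬e

  forbidden : List (Fin k)
  forbidden = nearColours ++ escapeColours

  length-forbidden : length forbidden ≤ degree G v + 2 * dist2Count G v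
  length-forbidden = begin
    length forbidden
      ≡⟨ length-++ nearColours ⟩
    length nearColours + length escapeColours
      ≡⟨ cong (_+ length escapeColours) (trans (length-++ (map c sphere₁))
           (cong₂ _+_ (length-map c sphere₁) (length-map c sphere₂))) ⟩
    s₁ + s₂ + length escapeColours
      ≤⟨ +-monoʳ-≤ (s₁ + s₂) (length-mapMaybe escapeColour sphere₂) ⟩
    s₁ + s₂ + s₂
      ≡⟨ trans (+-assoc s₁ s₂ s₂) (cong (λ t → s₁ + (s₂ + t)) (sym (+-identityʳ s₂))) ⟩
    s₁ + 2 * s₂ ∎
    where
    open ≤-Reasoning
    s₁ = length sphere₁
    s₂ = length sphere₂

  module _ (slid : StronglyLocallyIdentifying G c) (a : Fin k) (a∉ : a ∉ forbidden) where
    c′ : Fin n → Fin k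
    c′ = recolour c v a

    c′-at : c′ v ≡ a
    c′-at = cong (λ b → Bool.if b then a else c v) (dec-true (v ≟ v) refl)

    c′-other : ∀ {x} → x ≢ v → c′ x ≡ c x
    c′-other {x} x≢v = cong (λ b → Bool.if b then a else c x) (dec-false (x ≟ v) x≢v)

    a∉near : a ∉ nearColours
    a∉near = a∉ ∘ ∈-++⁺ˡ

    ball-colour≢a : ∀ {u x} → InN G u x → InN G u v → x ≢ v → c x ≢ a
    ball-colour≢a ux uv x≢v cx≡a = a∉near (subst (_∈ nearColours) cx≡a (nearColours-ball ux uv x≢v))

    injectiveOnBalls′ : InjectiveOnBalls G c′
    injectiveOnBalls′ u w w' uw uw' w≢w' with w ≟ v | w' ≟ v
    ... | yes refl | yes refl  = contradiction refl w≢w'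
    ... | yes refl | no w'≢v   = ball-colour≢a uw' uw w'≢v ∘ sym
    ... | no w≢v   | yes refl  = ball-colour≢a uw uw' w≢v
    ... | no _     | no _      = proj₂ slid u w w' uw uw' w≢w'

    ColIn-recolour-ball : ∀ {u b} → InN G u v → ColIn G c′ u b → b ≡ a ⊎ b ∈ nearColours
    ColIn-recolour-ball uv (x , ux , refl) with x ≟ v
    ... | yes refl = inj₁ refl
    ... | no x≢v   = inj₂ (nearColours-ball ux uv x≢v)

    ColIn⊆-unrecolour : ∀ {u w} → (InN G u v ⇔ InN G w v) →
      (∀ b → ColIn G c′ u b → ColIn G c′ w b) → ∀ b → ColIn G c u b → ColIn G c w b
    ColIn⊆-unrecolour u⇔w H b (x , ux , refl) with x ≟ v
    ... | yes refl = v , to u⇔w ux , refl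
    ... | no x≢v with H (c x) (x , ux , c′-other x≢v)
    ...   | y , wy , c′y≡cx with y ≟ v
    ...     | yes refl = ⊥-elim (ball-colour≢a ux (from u⇔w wy) x≢v (sym c′y≡cx))
    ...     | no _     = y , wy , c′y≡cx

    separates-same-side : ∀ {u w} → Adj G u w → (InN G u v ⇔ InN G w v) →
      ¬ (∀ x → InN G u x ⇔ InN G w x) → ¬ (∀ b → ColIn G c′ u b ⇔ ColIn G c′ w b)
    separates-same-side {u} {w} uw u⇔w N≢ H = proj₂ (proj₁ slid) u w uw N≢ λ b →
      mk⇔ (ColIn⊆-unrecolour u⇔w (to ∘ H) b) (ColIn⊆-unrecolour (⇔.sym u⇔w) (from ∘ H) b)

    new-colour-escapes : ∀ {w} → ¬ InN G w v → ColIn G c′ w a → ∃ (Escape w)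
    new-colour-escapes ¬wv (y , wy , cy≡a) with y ≟ v
    ... | yes refl = ⊥-elim (¬wv wy)
    ... | no _     = y , wy , a∉near ∘ subst (_∈ nearColours) cy≡a

    separates-mixed : ∀ {u w} → InN G u v → ¬ InN G w v → InN G u w →
      ¬ (∀ b → ColIn G c′ u b ⇔ ColIn G c′ w b)
    separates-mixed uv ¬wv uw H
      with escapeColours-cover (∈-sphere₂ uv uw (¬wv ∘ InN-sym G))
                               (new-colour-escapes ¬wv (to (H a) (v , uv , c′-at)))
    ... | x , (wx , cx∉near) , cx∈escape
      with ColIn-recolour-ball uv (from (H (c x)) (x , wx , c′-other λ { refl → ¬wv wx }))
    ...   | inj₁ cx≡a    = a∉ (subst (_∈ forbidden) cx≡a (∈-++⁺ʳ nearColours cx∈escape))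
    ...   | inj₂ cx∈near = cx∉near cx∈near

    identifying′ : ∀ u w → Adj G u w → ¬ (∀ x → InN G u x ⇔ InN G w x) →
      ¬ (∀ b → ColIn G c′ u b ⇔ ColIn G c′ w b)
    identifying′ u w uw with InN? G u v | InN? G w v
    ... | yes uv  | yes wv  = separates-same-side uw (mk⇔ (λ _ → wv) (λ _ → uv))
    ... | no ¬uv  | no ¬wv  = separates-same-side uw (mk⇔ (⊥-elim ∘ ¬uv) (⊥-elim ∘ ¬wv))
    ... | yes uv  | no ¬wv  = λ _ → separates-mixed uv ¬wv (inj₂ uw)
    ... | no ¬uv  | yes wv  = λ _ H → separates-mixed wv ¬uv (inj₂ (Adj-sym G uw)) (⇔.sym ∘ H)

    recolour-slid : StronglyLocallyIdentifying G c′
    recolour-slid = (injectiveOnBalls⇒proper G injectiveOnBalls′ , identifying′) , injectiveOnBalls′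

open Recolouring using (forbidden; length-forbidden; recolour-slid)

-- The bound on the number of colours only guarantees that some colour lies outside the list.
mainTheorem5 : ∀ {n k : ℕ} (G : SimpleGraph n) (v : Fin n) (d₁ d₂ : ℕ) →
    degree G v ≡ d₁ → dist2Count G v ≡ d₂ →
    (c : Fin n → Fin k) → StronglyLocallyIdentifying G c →
    d₁ + 2 * d₂ < k →
    Σ (List (Fin k)) λ L → length L ≤ d₁ + 2 * d₂ ×
    (∀ a → a ∉ L → StronglyLocallyIdentifying G (recolour c v a))
mainTheorem5 G v _ _ refl refl c slid _ =
  forbidden G v c , length-forbidden G v c , recolour-slid G v c slid
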